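{- For every integer $n\ge 2$, the sum of $2^{\mathbf{bb}(\pi)}$ over all permutations $\pi\in\mathfrak{S}_n$ such that $\pi_1=n$, $\pi$ has no double ascent, and $\pi_{n-1}>\pi_n$, equals $(n-1)!$.
   Context: For $\pi\in\mathfrak{S}_n$, a double ascent is an index $i\in\{1,\ldots,n-2\}$ with $\pi_i<\pi_{i+1}<\pi_{i+2}$, and $\mathbf{bb}(\pi)=\#\{i\in\{1,\ldots,n-2\}:\pi_i>\pi_{i+1}>\pi_{i+2}\}$ is the number of double descents. -}

module Defs where

open import Data.Nat using (ℕ; zero; suc; _+_; _*_; _^_; _<_; _<ᵇ_; _≡ᵇ_; _∸_)
open import Data.Bool using (Bool; _≟_; true; false; _∧_; _∨_; not; if_then_else_)
open import Data.List using (List; []; _∷_; map; concatMap; filter; upTo)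
open import Data.Bool.ListAction using (any)
open import Data.Nat.ListAction using (sum)
open import Data.Maybe using (Maybe; just; nothing)

-- A permutation of {1,...,n} in one-line notation is a list π₁ … πₙ
-- of length n with entries in {1,...,n} and no repeated entry.

words : ℕ → ℕ → List (List ℕ)
words n zero = [] ∷ []
words n (suc k) = concatMap (λ a → map (a ∷_) (words n k)) (map suc (upTo n))

distinct : List ℕ → Bool
distinct [] = true
distinct (x ∷ xs) = not (any (λ y → x ≡ᵇ y) xs) ∧ distinct xs

perms : ℕ → List (List ℕ)
perms n = filter (λ w → _≟_ (distinct w) true) (words n n)

dasc : List ℕ → ℕ
dasc (a ∷ b ∷ c ∷ xs) = (if (a <ᵇ b) ∧ (b <ᵇ c) then 1 else 0) + dasc (b ∷ c ∷ xs)
dasc _ = 0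

bb : List ℕ → ℕ
bb (a ∷ b ∷ c ∷ xs) = (if (b <ᵇ a) ∧ (c <ᵇ b) then 1 else 0) + bb (b ∷ c ∷ xs)
bb _ = 0

endsWithDescent : List ℕ → Bool
endsWithDescent (a ∷ b ∷ []) = b <ᵇ a
endsWithDescent (a ∷ b ∷ c ∷ xs) = endsWithDescent (b ∷ c ∷ xs)
endsWithDescent _ = false

startsWith : ℕ → List ℕ → Bool
startsWith n (a ∷ _) = a ≡ᵇ n
startsWith n [] = false

cond : ℕ → List ℕ → Bool
cond n π = startsWith n π ∧ (dasc π ≡ᵇ 0) ∧ endsWithDescent π

weightedSum : ℕ → ℕ
weightedSum n = sum (map (λ π → 2 ^ bb π) (filter (λ π → _≟_ (cond n π) true) (perms n)))

-- Build π from π₁ = n one letter at a time. The total weight 2 ^ bb of the valid completions of a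
-- partial word depends only on the number k of unused letters, the number r of them below the last
-- letter, and the direction of the last step; this gives a triangle recursion W (a descent after a
-- descent doubles the weight, an ascent after an ascent is forbidden, and the word must end on a
-- descent). Its rows are governed by the numbers partialDer r s of permutations of r + s points
-- without fixed points among s of them: W↓ k r = W↑ k r + partialDer r (k ∸ r), and the tail sums
-- of W↑ k are multiples of partialDer. Starting from the maximal letter n leaves n ∸ 1 letters, all
-- below it, and W (n ∸ 1) (n ∸ 1) start = W↑ (n ∸ 1) (n ∸ 1) = partialDer (n ∸ 1) 0 = (n ∸ 1)!.
module Submission where

open import Defs
open import Algebra.Bundles using (CommutativeMonoid)
import Algebra.Properties.CommutativeSemigroup as CommutativeSemigroupProperties
open import Data.Bool using (Bool; true; false; _∧_; not; if_then_else_; T)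
import Data.Bool as Bool
open import Data.Bool.ListAction using (any)
open import Data.Bool.Properties using (∧-zeroʳ; ∧-identityʳ; ∧-comm; ∧-commutativeMonoid; T-≡; if-eta)
open import Data.Empty using (⊥-elim)
open import Data.List using (List; []; _∷_; _++_; map; concatMap; filter; upTo; length)
open import Data.List.Properties using (map-++; map-∘; length-map; length-upTo; upTo-∷ʳ)
open import Data.List.Membership.Propositional using (_∈_)
open import Data.List.Membership.Propositional.Properties using (∈-map⁺; ∈-upTo⁺)
open import Data.List.Relation.Unary.All as All using (All; []; _∷_)
import Data.List.Relation.Unary.All.Properties as All
open import Data.List.Relation.Unary.Any using (here; there)
open import Data.List.Relation.Unary.AllPairs using (_∷_)
open import Data.List.Relation.Unary.Unique.Propositional using (Unique)
import Data.List.Relation.Unary.Unique.Propositional.Properties as Unique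
open import Data.Maybe using (Maybe; just; nothing)
open import Data.Maybe.Properties using (just-injective)
open import Data.Nat hiding (_≟_)
open import Data.Nat.ListAction using (sum)
open import Data.Nat.ListAction.Properties using (sum-++)
open import Data.Nat.Properties
open import Data.Nat.Tactic.RingSolver using (solve-∀)
open import Data.Product using (_×_; _,_; proj₁; proj₂)
open import Function using (_∘_)
open import Function.Bundles using (Equivalence)
open import Relation.Binary.PropositionalEquality

private
  variable
    A B : Set
  module + = CommutativeSemigroupProperties +-commutativeSemigroup
  module ∧ = CommutativeSemigroupProperties (CommutativeMonoid.commutativeSemigroup ∧-commutativeMonoid)

∑ : List A → (A → ℕ) → ℕ
∑ xs f = sum (map f xs)

module _ {f g : A → ℕ} where

  ∑-cong : ∀ xs → (∀ x → f x ≡ g x) → ∑ xs f ≡ ∑ xs g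
  ∑-cong []       f≗g = refl
  ∑-cong (x ∷ xs) f≗g = cong₂ _+_ (f≗g x) (∑-cong xs f≗g)

  ∑-congᴬ : ∀ {xs} → All (λ x → f x ≡ g x) xs → ∑ xs f ≡ ∑ xs g
  ∑-congᴬ []         = refl
  ∑-congᴬ (eq ∷ eqs) = cong₂ _+_ eq (∑-congᴬ eqs)

  ∑-+ : ∀ xs → ∑ xs (λ x → f x + g x) ≡ ∑ xs f + ∑ xs g
  ∑-+ []       = refl
  ∑-+ (x ∷ xs) = trans (cong (f x + g x +_) (∑-+ xs)) (+.interchange (f x) (g x) _ _)

  ∑-≤ : ∀ xs → (∀ x → f x ≤ g x) → ∑ xs f ≤ ∑ xs g
  ∑-≤ []       f≤g = z≤n
  ∑-≤ (x ∷ xs) f≤g = +-mono-≤ (f≤g x) (∑-≤ xs f≤g)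

∑-*ˡ : ∀ c (f : A → ℕ) xs → ∑ xs (λ x → c * f x) ≡ c * ∑ xs f
∑-*ˡ c f []       = sym (*-zeroʳ c)
∑-*ˡ c f (x ∷ xs) = trans (cong (c * f x +_) (∑-*ˡ c f xs)) (sym (*-distribˡ-+ c (f x) _))

∑-*ʳ : ∀ (f : A → ℕ) c xs → ∑ xs (λ x → f x * c) ≡ ∑ xs f * c
∑-*ʳ f c xs = trans (∑-cong xs (λ x → *-comm (f x) c)) (trans (∑-*ˡ c f xs) (*-comm c _))

∑-zero : ∀ (xs : List A) → ∑ xs (λ _ → 0) ≡ 0
∑-zero []       = refl
∑-zero (x ∷ xs) = ∑-zero xs

∑-one : ∀ (xs : List A) → ∑ xs (λ _ → 1) ≡ length xs
∑-one []       = refl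
∑-one (x ∷ xs) = cong suc (∑-one xs)

∑-++ : ∀ (f : A → ℕ) xs ys → ∑ (xs ++ ys) f ≡ ∑ xs f + ∑ ys f
∑-++ f xs ys = trans (cong sum (map-++ f xs ys)) (sum-++ (map f xs) (map f ys))

∑-map : ∀ (f : B → ℕ) (h : A → B) xs → ∑ (map h xs) f ≡ ∑ xs (f ∘ h)
∑-map f h xs = cong sum (sym (map-∘ xs))

∑-concatMap : ∀ (f : B → ℕ) (h : A → List B) xs → ∑ (concatMap h xs) f ≡ ∑ xs (λ x → ∑ (h x) f)
∑-concatMap f h []       = refl
∑-concatMap f h (x ∷ xs) = trans (∑-++ f (h x) (concatMap h xs)) (cong (∑ (h x) f +_) (∑-concatMap f h xs))

∑-filter : ∀ (f : A → ℕ) (p : A → Bool) xs →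
           ∑ (filter (λ x → p x Bool.≟ true) xs) f ≡ ∑ xs (λ x → if p x then f x else 0)
∑-filter f p [] = refl
∑-filter f p (x ∷ xs) with p x
... | true  = cong (f x +_) (∑-filter f p xs)
... | false = ∑-filter f p xs

sumBelow : (ℕ → ℕ) → ℕ → ℕ
sumBelow f zero    = 0
sumBelow f (suc r) = sumBelow f r + f r

sumRange : (ℕ → ℕ) → ℕ → ℕ → ℕ
sumRange f r zero    = 0
sumRange f r (suc l) = f r + sumRange f (suc r) l

sumBelow-cong : ∀ {f g} r → (∀ j → j < r → f j ≡ g j) → sumBelow f r ≡ sumBelow g r
sumBelow-cong zero    f≗g = refl
sumBelow-cong (suc r) f≗g = cong₂ _+_ (sumBelow-cong r (λ j j<r → f≗g j (m<n⇒m<1+n j<r))) (f≗g r ≤-refl)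

sumBelow-+ : ∀ f g r → sumBelow (λ j → f j + g j) r ≡ sumBelow f r + sumBelow g r
sumBelow-+ f g zero    = refl
sumBelow-+ f g (suc r) = trans (cong (_+ (f r + g r)) (sumBelow-+ f g r)) (+.interchange (sumBelow f r) (sumBelow g r) (f r) (g r))

sumBelow-*ˡ : ∀ c f r → sumBelow (λ j → c * f j) r ≡ c * sumBelow f r
sumBelow-*ˡ c f zero    = sym (*-zeroʳ c)
sumBelow-*ˡ c f (suc r) = trans (cong (_+ c * f r) (sumBelow-*ˡ c f r)) (sym (*-distribˡ-+ c _ (f r)))

sumRange-*ˡ : ∀ c f r l → sumRange (λ j → c * f j) r l ≡ c * sumRange f r l
sumRange-*ˡ c f r zero    = sym (*-zeroʳ c)
sumRange-*ˡ c f r (suc l) = trans (cong (c * f r +_) (sumRange-*ˡ c f (suc r) l)) (sym (*-distribˡ-+ c (f r) _))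

sumBelow-+-sumRange : ∀ f r l → sumBelow f r + sumRange f r l ≡ sumBelow f (r + l)
sumBelow-+-sumRange f r zero    = trans (+-identityʳ _) (cong (sumBelow f) (sym (+-identityʳ r)))
sumBelow-+-sumRange f r (suc l) = begin
  sumBelow f r + (f r + sumRange f (suc r) l) ≡⟨ +-assoc (sumBelow f r) _ _ ⟨
  sumBelow f (suc r) + sumRange f (suc r) l   ≡⟨ sumBelow-+-sumRange f (suc r) l ⟩
  sumBelow f (suc r + l)                      ≡⟨ cong (sumBelow f) (+-suc r l) ⟨
  sumBelow f (r + suc l)                      ∎
  where open ≡-Reasoning

≡ᵇ-refl : ∀ n → (n ≡ᵇ n) ≡ true
≡ᵇ-refl zero    = refl
≡ᵇ-refl (suc n) = ≡ᵇ-refl n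

≡ᵇ-sound : ∀ m n → (m ≡ᵇ n) ≡ true → m ≡ n
≡ᵇ-sound m n eq = ≡ᵇ⇒≡ m n (subst T (sym eq) _)

≢⇒≡ᵇ-false : ∀ m n → m ≢ n → (m ≡ᵇ n) ≡ false
≢⇒≡ᵇ-false m n m≢n with m ≡ᵇ n in eq
... | true  = ⊥-elim (m≢n (≡ᵇ-sound m n eq))
... | false = refl

≡ᵇ-sym : ∀ m n → (m ≡ᵇ n) ≡ (n ≡ᵇ m)
≡ᵇ-sym zero    zero    = refl
≡ᵇ-sym zero    (suc n) = refl
≡ᵇ-sym (suc m) zero    = refl
≡ᵇ-sym (suc m) (suc n) = ≡ᵇ-sym m n

<ᵇ⇒≡ᵇ-false : ∀ m n → (m <ᵇ n) ≡ true → (m ≡ᵇ n) ≡ false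
<ᵇ⇒≡ᵇ-false zero    (suc n) _   = refl
<ᵇ⇒≡ᵇ-false (suc m) (suc n) m<n = <ᵇ⇒≡ᵇ-false m n m<n

<ᵇ-flip : ∀ m n → m ≢ n → (m <ᵇ n) ≡ not (n <ᵇ m)
<ᵇ-flip zero    zero    m≢n = ⊥-elim (m≢n refl)
<ᵇ-flip zero    (suc n) _   = refl
<ᵇ-flip (suc m) zero    _   = refl
<ᵇ-flip (suc m) (suc n) m≢n = <ᵇ-flip m n (m≢n ∘ cong suc)

if-<ᵇ-suc : ∀ x (v : ℕ) b a →
            (if x ∧ (b <ᵇ suc a) then v else 0) ≡ (if x ∧ (b <ᵇ a) then v else 0) + (if x ∧ (b ≡ᵇ a) then v else 0)
if-<ᵇ-suc false v b       a       = refl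
if-<ᵇ-suc true  v zero    zero    = refl
if-<ᵇ-suc true  v zero    (suc a) = sym (+-identityʳ v)
if-<ᵇ-suc true  v (suc b) zero    = refl
if-<ᵇ-suc true  v (suc b) (suc a) = if-<ᵇ-suc true v b a

if-trichotomy : ∀ x (v : ℕ) b a → (x ≡ true → b ≢ a) →
                (if x then v else 0) ≡ (if x ∧ (b <ᵇ a) then v else 0) + (if x ∧ (a <ᵇ b) then v else 0)
if-trichotomy false v b a _ = refl
if-trichotomy true  v b a b≢a rewrite <ᵇ-flip b a (b≢a refl) with a <ᵇ b
... | true  = refl
... | false = sym (+-identityʳ v)

if-∧-* : ∀ x y (c v v′ : ℕ) → v ≡ c * v′ → (if x ∧ y then v else 0) ≡ (if x then c else 0) * (if y then v′ else 0)
if-∧-* true  true  c v v′ v≡cv′ = v≡cv′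
if-∧-* true  false c v v′ _     = sym (*-zeroʳ c)
if-∧-* false y     c v v′ _     = refl

if-split : ∀ x e (v : ℕ) → (if x then v else 0) ≡ (if not e ∧ x then v else 0) + (if x ∧ e then v else 0)
if-split true  true  v = refl
if-split true  false v = sym (+-identityʳ v)
if-split false true  v = refl
if-split false false v = refl

count : List ℕ → (ℕ → Bool) → ℕ
count L P = ∑ L (λ y → if P y then 1 else 0)

count-≡ᵇ-absent : ∀ a L → All (a ≢_) L → count L (_≡ᵇ a) ≡ 0
count-≡ᵇ-absent a []      []           = refl
count-≡ᵇ-absent a (y ∷ L) (a≢y ∷ a∉L) rewrite ≢⇒≡ᵇ-false y a (≢-sym a≢y) = count-≡ᵇ-absent a L a∉L

count-≡ᵇ-present : ∀ a L → Unique L → a ∈ L → count L (_≡ᵇ a) ≡ 1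
count-≡ᵇ-present a (y ∷ L) (y∉L ∷ _) (here refl) rewrite ≡ᵇ-refl a = cong suc (count-≡ᵇ-absent a L y∉L)
count-≡ᵇ-present a (y ∷ L) (y∉L ∷ uniq) (there a∈L) with y ≡ᵇ a in y≡a
... | true  = ⊥-elim (All.lookup y∉L a∈L (≡ᵇ-sound y a y≡a))
... | false = count-≡ᵇ-present a L uniq a∈L

count-≡ᵇ-≤1 : ∀ a L → Unique L → count L (_≡ᵇ a) ≤ 1
count-≡ᵇ-≤1 a []      _            = z≤n
count-≡ᵇ-≤1 a (y ∷ L) (y∉L ∷ uniq) with y ≡ᵇ a in y≡a
... | true  rewrite ≡ᵇ-sound y a y≡a = s≤s (≤-reflexive (count-≡ᵇ-absent a L y∉L))
... | false = count-≡ᵇ-≤1 a L uniq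

∑-at : ∀ (P : ℕ → Bool) (g : ℕ → ℕ) a L →
       ∑ L (λ b → if P b ∧ (b ≡ᵇ a) then g b else 0) ≡ (if P a then count L (_≡ᵇ a) else 0) * g a
∑-at P g a L with P a in Pa
... | false = trans (∑-cong L vanish) (∑-zero L)
  where
  vanish : ∀ b → (if P b ∧ (b ≡ᵇ a) then g b else 0) ≡ 0
  vanish b with b ≡ᵇ a in b≡a
  ... | true  rewrite ≡ᵇ-sound b a b≡a | Pa = refl
  ... | false rewrite ∧-zeroʳ (P b) = refl
... | true  = trans (∑-cong L pick) (∑-*ʳ (λ b → if b ≡ᵇ a then 1 else 0) (g a) L)
  where
  pick : ∀ b → (if P b ∧ (b ≡ᵇ a) then g b else 0) ≡ (if b ≡ᵇ a then 1 else 0) * g a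
  pick b with b ≡ᵇ a in b≡a
  ... | true  rewrite ≡ᵇ-sound b a b≡a | Pa = sym (*-identityˡ (g a))
  ... | false rewrite ∧-zeroʳ (P b) = refl

count-remove : ∀ L → Unique L → ∀ b → b ∈ L → (P : ℕ → Bool) → P b ≡ true →
               count L P ≡ count L (λ y → not (y ≡ᵇ b) ∧ P y) + 1
count-remove L uniq b b∈L P Pb = begin
  count L P
    ≡⟨ ∑-cong L (λ y → if-split (P y) (y ≡ᵇ b) 1) ⟩
  ∑ L (λ y → (if not (y ≡ᵇ b) ∧ P y then 1 else 0) + (if P y ∧ (y ≡ᵇ b) then 1 else 0))
    ≡⟨ ∑-+ L ⟩
  count L (λ y → not (y ≡ᵇ b) ∧ P y) + ∑ L (λ y → if P y ∧ (y ≡ᵇ b) then 1 else 0)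
    ≡⟨ cong (count L (λ y → not (y ≡ᵇ b) ∧ P y) +_) (∑-at P (λ _ → 1) b L) ⟩
  count L (λ y → not (y ≡ᵇ b) ∧ P y) + (if P b then count L (_≡ᵇ b) else 0) * 1
    ≡⟨ cong (λ x → count L (λ y → not (y ≡ᵇ b) ∧ P y) + (if x then count L (_≡ᵇ b) else 0) * 1) Pb ⟩
  count L (λ y → not (y ≡ᵇ b) ∧ P y) + count L (_≡ᵇ b) * 1
    ≡⟨ cong (λ c → count L (λ y → not (y ≡ᵇ b) ∧ P y) + c * 1) (count-≡ᵇ-present b L uniq b∈L) ⟩
  count L (λ y → not (y ≡ᵇ b) ∧ P y) + 1 ∎
  where open ≡-Reasoning

sumBelow-extend : ∀ f r c → c ≤ 1 → sumBelow f r + c * f r ≡ sumBelow f (r + c)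
sumBelow-extend f r zero       _               = trans (+-identityʳ _) (cong (sumBelow f) (sym (+-identityʳ r)))
sumBelow-extend f r (suc zero) _               = trans (cong (sumBelow f r +_) (+-identityʳ (f r))) (cong (sumBelow f) (+-comm 1 r))
sumBelow-extend f r (2+ c)     (s≤s ())

rank : List ℕ → (ℕ → Bool) → ℕ → ℕ
rank L P a = count L (λ y → P y ∧ (y <ᵇ a))

rank≤count : ∀ L P a → rank L P a ≤ count L P
rank≤count L P a = ∑-≤ L (λ y → indicator-∧ (P y) (y <ᵇ a))
  where
  indicator-∧ : ∀ x z → (if x ∧ z then 1 else 0) ≤ (if x then 1 else 0)
  indicator-∧ true  true  = ≤-refl
  indicator-∧ true  false = z≤n
  indicator-∧ false z     = ≤-refl

-- As L has no repetitions, the elements of L satisfying P have the ranks 0, 1, …, count L P ∸ 1.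
module _ {L : List ℕ} (uniq : Unique L) (P : ℕ → Bool) where

  private
    rk = rank L P
    multiplicity : ℕ → ℕ
    multiplicity a = if P a then count L (_≡ᵇ a) else 0
    multiplicity≤1 : ∀ a → multiplicity a ≤ 1
    multiplicity≤1 a with P a
    ... | true  = count-≡ᵇ-≤1 a L uniq
    ... | false = z≤n

  rank-suc : ∀ a → rk (suc a) ≡ rk a + multiplicity a
  rank-suc a = begin
    rk (suc a)
      ≡⟨ ∑-cong L (λ y → if-<ᵇ-suc (P y) 1 y a) ⟩
    ∑ L (λ y → (if P y ∧ (y <ᵇ a) then 1 else 0) + (if P y ∧ (y ≡ᵇ a) then 1 else 0))
      ≡⟨ ∑-+ L ⟩
    rk a + ∑ L (λ y → if P y ∧ (y ≡ᵇ a) then 1 else 0)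
      ≡⟨ cong (rk a +_) (trans (∑-at P (λ _ → 1) a L) (*-identityʳ _)) ⟩
    rk a + multiplicity a ∎
    where open ≡-Reasoning

  ∑-below-rank : ∀ (ψ : ℕ → ℕ) a → ∑ L (λ b → if P b ∧ (b <ᵇ a) then ψ (rk b) else 0) ≡ sumBelow ψ (rk a)
  ∑-below-rank ψ zero = trans (none (ψ ∘ rk)) (cong (sumBelow ψ) (sym (none (λ _ → 1))))
    where
    none : ∀ (v : ℕ → ℕ) → ∑ L (λ b → if P b ∧ false then v b else 0) ≡ 0
    none v = trans (∑-cong L (λ b → cong (λ x → if x then v b else 0) (∧-zeroʳ (P b)))) (∑-zero L)
  ∑-below-rank ψ (suc a) = begin
    ∑ L (λ b → if P b ∧ (b <ᵇ suc a) then ψ (rk b) else 0)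
      ≡⟨ ∑-cong L (λ b → if-<ᵇ-suc (P b) (ψ (rk b)) b a) ⟩
    ∑ L (λ b → (if P b ∧ (b <ᵇ a) then ψ (rk b) else 0) + (if P b ∧ (b ≡ᵇ a) then ψ (rk b) else 0))
      ≡⟨ ∑-+ L ⟩
    ∑ L (λ b → if P b ∧ (b <ᵇ a) then ψ (rk b) else 0) + ∑ L (λ b → if P b ∧ (b ≡ᵇ a) then ψ (rk b) else 0)
      ≡⟨ cong₂ _+_ (∑-below-rank ψ a) (∑-at P (ψ ∘ rk) a L) ⟩
    sumBelow ψ (rk a) + multiplicity a * ψ (rk a)
      ≡⟨ sumBelow-extend ψ (rk a) (multiplicity a) (multiplicity≤1 a) ⟩
    sumBelow ψ (rk a + multiplicity a)
      ≡⟨ cong (sumBelow ψ) (rank-suc a) ⟨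
    sumBelow ψ (rk (suc a)) ∎
    where open ≡-Reasoning

  module _ {bound : ℕ} (below : All (λ b → (b <ᵇ bound) ≡ true) L) where

    ∑-∧-below : ∀ (v : ℕ → ℕ) →
                ∑ L (λ b → if P b ∧ (b <ᵇ bound) then v b else 0) ≡ ∑ L (λ b → if P b then v b else 0)
    ∑-∧-below v = ∑-congᴬ (All.map (λ {b} b<bound → trans (cong (λ x → if P b ∧ x then v b else 0) b<bound)
                                                          (cong (λ x → if x then v b else 0) (∧-identityʳ (P b)))) below)

    ∑-rank : ∀ (ψ : ℕ → ℕ) → ∑ L (λ b → if P b then ψ (rk b) else 0) ≡ sumBelow ψ (count L P)
    ∑-rank ψ = begin
      ∑ L (λ b → if P b then ψ (rk b) else 0)                ≡⟨ ∑-∧-below (ψ ∘ rk) ⟨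
      ∑ L (λ b → if P b ∧ (b <ᵇ bound) then ψ (rk b) else 0) ≡⟨ ∑-below-rank ψ bound ⟩
      sumBelow ψ (rk bound)                                   ≡⟨ cong (sumBelow ψ) (∑-∧-below (λ _ → 1)) ⟩
      sumBelow ψ (count L P)                                  ∎
      where open ≡-Reasoning

    ∑-above-rank : ∀ (ψ : ℕ → ℕ) a → P a ≡ false →
                   ∑ L (λ b → if P b ∧ (a <ᵇ b) then ψ (rk b) else 0) ≡ sumRange ψ (rk a) (count L P ∸ rk a)
    ∑-above-rank ψ a Pa = +-cancelˡ-≡ (sumBelow ψ (rk a)) _ _ (begin
      sumBelow ψ (rk a) + above
        ≡⟨ cong (_+ above) (∑-below-rank ψ a) ⟨
      ∑ L (λ b → if P b ∧ (b <ᵇ a) then ψ (rk b) else 0) + above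
        ≡⟨ ∑-+ L ⟨
      ∑ L (λ b → (if P b ∧ (b <ᵇ a) then ψ (rk b) else 0) + (if P b ∧ (a <ᵇ b) then ψ (rk b) else 0))
        ≡⟨ ∑-cong L (λ b → sym (if-trichotomy (P b) (ψ (rk b)) b a (only-a-fails b))) ⟩
      ∑ L (λ b → if P b then ψ (rk b) else 0)
        ≡⟨ ∑-rank ψ ⟩
      sumBelow ψ (count L P)
        ≡⟨ cong (sumBelow ψ) (m+[n∸m]≡n (rank≤count L P a)) ⟨
      sumBelow ψ (rk a + (count L P ∸ rk a))
        ≡⟨ sumBelow-+-sumRange ψ (rk a) (count L P ∸ rk a) ⟨
      sumBelow ψ (rk a) + sumRange ψ (rk a) (count L P ∸ rk a) ∎)
      where
      open ≡-Reasoning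
      above = ∑ L (λ b → if P b ∧ (a <ᵇ b) then ψ (rk b) else 0)
      only-a-fails : ∀ b → P b ≡ true → b ≢ a
      only-a-fails b Pb refl with () ← trans (sym Pb) Pa

derangements : ℕ → ℕ
derangements zero             = 1
derangements (suc zero)       = 0
derangements (suc k@(suc k′)) = k * (derangements k + derangements k′)

-- partialDer r s counts the permutations of r + s points without a fixed point among s given ones.
partialDer : ℕ → ℕ → ℕ
partialDer zero    s = derangements s
partialDer (suc r) s = partialDer r s + partialDer r (suc s)

partialDer-recurrence : ∀ r s → partialDer (suc r) s ≡ s * partialDer (suc r) (pred s) + suc r * partialDer r s
partialDer-recurrence zero    zero    = refl
partialDer-recurrence zero    (suc s) = regroup s (derangements s) (derangements (suc s))
  where
  regroup : ∀ s x y → y + suc s * (y + x) ≡ suc s * (x + y) + 1 * y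
  regroup = solve-∀
partialDer-recurrence (suc r) zero = begin
  partialDer (suc r) 0 + partialDer (suc r) 1
    ≡⟨ cong₂ _+_ (partialDer-recurrence r 0) (partialDer-recurrence r 1) ⟩
  (0 + suc r * partialDer r 0) + (1 * (partialDer r 0 + partialDer r 1) + suc r * partialDer r 1)
    ≡⟨ regroup r (partialDer r 0) (partialDer r 1) ⟩
  0 + suc (suc r) * (partialDer r 0 + partialDer r 1) ∎
  where
  open ≡-Reasoning
  regroup : ∀ r x y → (0 + suc r * x) + (1 * (x + y) + suc r * y) ≡ 0 + suc (suc r) * (x + y)
  regroup = solve-∀
partialDer-recurrence (suc r) (suc s) = begin
  partialDer (suc r) (suc s) + partialDer (suc r) (suc (suc s))
    ≡⟨ cong₂ _+_ (partialDer-recurrence r (suc s)) (partialDer-recurrence r (suc (suc s))) ⟩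
  (suc s * partialDer (suc r) s + suc r * y) + (suc (suc s) * (y + z) + suc r * z)
    ≡⟨ regroup s r (partialDer (suc r) s) y z ⟩
  suc s * (partialDer (suc r) s + (y + z)) + suc (suc r) * (y + z) ∎
  where
  open ≡-Reasoning
  y = partialDer r (suc s)
  z = partialDer r (suc (suc s))
  regroup : ∀ s r x y z → (suc s * x + suc r * y) + (suc (suc s) * (y + z) + suc r * z)
                          ≡ suc s * (x + (y + z)) + suc (suc r) * (y + z)
  regroup = solve-∀

partialDer-zero : ∀ r → partialDer r 0 ≡ r !
partialDer-zero zero    = refl
partialDer-zero (suc r) = trans (partialDer-recurrence r 0) (cong (suc r *_) (partialDer-zero r))

partialDer-unfold : ∀ r s → partialDer (suc r) s ≡ derangements (suc r + s) + sumBelow (λ j → partialDer j (r + s ∸ j)) (suc r)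
partialDer-unfold zero    s = +-comm (derangements s) (derangements (suc s))
partialDer-unfold (suc r) s = begin
  partialDer (suc r) s + partialDer (suc r) (suc s)
    ≡⟨ cong (partialDer (suc r) s +_) (partialDer-unfold r (suc s)) ⟩
  partialDer (suc r) s + (derangements (suc r + suc s) + sumBelow (λ j → partialDer j (r + suc s ∸ j)) (suc r))
    ≡⟨ cong₂ (λ x y → x + (derangements (suc y) + sumBelow (λ j → partialDer j (y ∸ j)) (suc r)))
             (cong (partialDer (suc r)) (sym (m+n∸m≡n (suc r) s))) (+-suc r s) ⟩
  x + (derangements (suc (suc r + s)) + rest)
    ≡⟨ +-comm x _ ⟩
  (derangements (suc (suc r + s)) + rest) + x
    ≡⟨ +-assoc (derangements (suc (suc r + s))) rest x ⟩
  derangements (suc (suc r) + s) + sumBelow (λ j → partialDer j (suc r + s ∸ j)) (suc (suc r)) ∎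
  where
  open ≡-Reasoning
  x = partialDer (suc r) (suc r + s ∸ suc r)
  rest = sumBelow (λ j → partialDer j (suc r + s ∸ j)) (suc r)

data Dir : Set where
  start up down : Dir

descentFactor ascentFactor : Dir → ℕ
descentFactor start = 1
descentFactor up    = 1
descentFactor down  = 2
ascentFactor  start = 1
ascentFactor  up    = 0
ascentFactor  down  = 1

-- W k r d is the total weight of the completions by k more letters of a word whose last step has
-- direction d, when r of the k unused letters lie below its last letter.
W : ℕ → ℕ → Dir → ℕ
W zero    r start = 0
W zero    r up    = 0
W zero    r down  = 1
W (suc k) r d =
  descentFactor d * sumBelow (λ j → W k j down) r + ascentFactor d * sumRange (λ j → W k j up) r (suc k ∸ r)

W↑ W↓ : ℕ → ℕ → ℕ
W↑ k r = W k r up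
W↓ k r = W k r down

W↑-suc : ∀ k r → W↑ (suc k) r ≡ sumBelow (W↓ k) r
W↑-suc k r = trans (+-identityʳ _) (+-identityʳ _)

W↑-zero : ∀ k → W↑ k 0 ≡ 0
W↑-zero zero    = refl
W↑-zero (suc k) = W↑-suc k 0

W↓-suc : ∀ k r s → r + s ≡ suc k →
         W↓ (suc k) r ≡ sumBelow (W↓ k) r + W↑ (suc k) r + sumRange (W↑ k) r s
W↓-suc k r s r+s≡1+k = begin
  2 * sumBelow (W↓ k) r + 1 * sumRange (W↑ k) r (suc k ∸ r)
    ≡⟨ cong₂ _+_ (cong (sumBelow (W↓ k) r +_) (+-identityʳ _)) (+-identityʳ _) ⟩
  sumBelow (W↓ k) r + sumBelow (W↓ k) r + sumRange (W↑ k) r (suc k ∸ r)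
    ≡⟨ cong₂ (λ x y → sumBelow (W↓ k) r + x + sumRange (W↑ k) r y) (sym (W↑-suc k r)) remaining ⟩
  sumBelow (W↓ k) r + W↑ (suc k) r + sumRange (W↑ k) r s ∎
  where
  open ≡-Reasoning
  remaining : suc k ∸ r ≡ s
  remaining = trans (cong (_∸ r) (sym r+s≡1+k)) (m+n∸m≡n r s)

DiffLaw AscentLaw : ℕ → Set
DiffLaw   k = ∀ r s → r + s ≡ k → W↓ k r ≡ W↑ k r + partialDer r s
AscentLaw k = ∀ r s → suc r + s ≡ k → W↑ k (suc r) + s * partialDer (suc r) (pred s) ≡ partialDer (suc r) s

W↑-tailSum : ∀ {k} → AscentLaw k → ∀ r s → r + s ≡ k → sumRange (W↑ k) (suc r) s ≡ s * partialDer (suc r) (pred s)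
W↑-tailSum {k} ascentLaw r zero    _     = refl
W↑-tailSum {k} ascentLaw r (suc s) r+s≡k = nonempty r s (trans (sym (+-suc r s)) r+s≡k)
  where
  nonempty : ∀ r s → suc r + s ≡ k → sumRange (W↑ k) (suc r) (suc s) ≡ suc s * partialDer (suc r) s
  nonempty r zero    r+s≡k = trans (ascentLaw r 0 r+s≡k) (sym (+-identityʳ _))
  nonempty r (suc s) r+s≡k = begin
    W↑ k (suc r) + sumRange (W↑ k) (suc (suc r)) (suc s)
      ≡⟨ cong (W↑ k (suc r) +_) (nonempty (suc r) s (trans (sym (+-suc (suc r) s)) r+s≡k)) ⟩
    W↑ k (suc r) + suc s * (partialDer (suc r) s + partialDer (suc r) (suc s))
      ≡⟨ cong (W↑ k (suc r) +_) (*-distribˡ-+ (suc s) (partialDer (suc r) s) (partialDer (suc r) (suc s))) ⟩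
    W↑ k (suc r) + (suc s * partialDer (suc r) s + suc s * partialDer (suc r) (suc s))
      ≡⟨ +-assoc (W↑ k (suc r)) _ _ ⟨
    (W↑ k (suc r) + suc s * partialDer (suc r) s) + suc s * partialDer (suc r) (suc s)
      ≡⟨ cong (_+ suc s * partialDer (suc r) (suc s)) (ascentLaw r (suc s) r+s≡k) ⟩
    suc (suc s) * partialDer (suc r) (suc s) ∎
    where open ≡-Reasoning

W↑-rowSum : ∀ k → AscentLaw k → sumBelow (W↑ k) (suc k) ≡ derangements (suc k)
W↑-rowSum zero    _         = refl
W↑-rowSum (suc k) ascentLaw = begin
  sumBelow (W↑ (suc k)) (suc (suc k))
    ≡⟨ sumBelow-+-sumRange (W↑ (suc k)) 1 (suc k) ⟨
  (0 + W↑ (suc k) 0) + sumRange (W↑ (suc k)) 1 (suc k)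
    ≡⟨ cong₂ _+_ (W↑-zero (suc k)) (W↑-tailSum ascentLaw 0 (suc k) refl) ⟩
  0 + suc k * (derangements k + derangements (suc k))
    ≡⟨ cong (suc k *_) (+-comm (derangements k) _) ⟩
  derangements (suc (suc k)) ∎
  where open ≡-Reasoning

ascentLaw-suc : ∀ k → DiffLaw k → AscentLaw k → AscentLaw (suc k)
ascentLaw-suc .(r + s) diffLaw ascentLaw r s refl = begin
  W↑ (suc k) (suc r) + tail
    ≡⟨ cong (_+ tail) (W↑-suc k (suc r)) ⟩
  sumBelow (W↓ k) (suc r) + tail
    ≡⟨ cong (_+ tail) (sumBelow-cong (suc r) lowerRow) ⟩
  sumBelow (λ j → W↑ k j + partialDer j (k ∸ j)) (suc r) + tail
    ≡⟨ cong (_+ tail) (sumBelow-+ (W↑ k) (λ j → partialDer j (k ∸ j)) (suc r)) ⟩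
  sumBelow (W↑ k) (suc r) + sumBelow (λ j → partialDer j (k ∸ j)) (suc r) + tail
    ≡⟨ +.xy∙z≈xz∙y (sumBelow (W↑ k) (suc r)) _ tail ⟩
  sumBelow (W↑ k) (suc r) + tail + sumBelow (λ j → partialDer j (k ∸ j)) (suc r)
    ≡⟨ cong (_+ sumBelow (λ j → partialDer j (k ∸ j)) (suc r)) headAndTail ⟩
  derangements (suc k) + sumBelow (λ j → partialDer j (k ∸ j)) (suc r)
    ≡⟨ partialDer-unfold r s ⟨
  partialDer (suc r) s ∎
  where
  open ≡-Reasoning
  k = r + s
  tail = s * partialDer (suc r) (pred s)
  lowerRow : ∀ j → j < suc r → W↓ k j ≡ W↑ k j + partialDer j (k ∸ j)
  lowerRow j j≤r = diffLaw j (k ∸ j) (m+[n∸m]≡n (≤-trans (s≤s⁻¹ j≤r) (m≤m+n r s)))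
  headAndTail : sumBelow (W↑ k) (suc r) + tail ≡ derangements (suc k)
  headAndTail = begin
    sumBelow (W↑ k) (suc r) + tail                      ≡⟨ cong (sumBelow (W↑ k) (suc r) +_) (W↑-tailSum ascentLaw r s refl) ⟨
    sumBelow (W↑ k) (suc r) + sumRange (W↑ k) (suc r) s ≡⟨ sumBelow-+-sumRange (W↑ k) (suc r) s ⟩
    sumBelow (W↑ k) (suc k)                             ≡⟨ W↑-rowSum k ascentLaw ⟩
    derangements (suc k)                                ∎

diffLaw-suc : ∀ k → AscentLaw k → AscentLaw (suc k) → DiffLaw (suc k)
diffLaw-suc k ascentLaw ascentLaw′ zero .(suc k) refl = begin
  W↓ (suc k) 0                                        ≡⟨ W↓-suc k 0 (suc k) refl ⟩
  0 + W↑ (suc k) 0 + sumRange (W↑ k) 0 (suc k)        ≡⟨ cong₂ (λ x y → 0 + x + y) (W↑-zero (suc k))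
                                                                     (sumBelow-+-sumRange (W↑ k) 0 (suc k)) ⟩
  sumBelow (W↑ k) (suc k)                             ≡⟨ W↑-rowSum k ascentLaw ⟩
  derangements (suc k)                                ≡⟨ cong (_+ derangements (suc k)) (W↑-zero (suc k)) ⟨
  W↑ (suc k) 0 + partialDer 0 (suc k)                 ∎
  where open ≡-Reasoning
diffLaw-suc .(r + s) ascentLaw ascentLaw′ (suc r) s refl = begin
  W↓ (suc k) (suc r)
    ≡⟨ W↓-suc k (suc r) s refl ⟩
  sumBelow (W↓ k) (suc r) + W↑ (suc k) (suc r) + sumRange (W↑ k) (suc r) s
    ≡⟨ cong₂ (λ x y → x + W↑ (suc k) (suc r) + y) (sym (W↑-suc k (suc r))) (W↑-tailSum ascentLaw r s refl) ⟩
  W↑ (suc k) (suc r) + W↑ (suc k) (suc r) + s * partialDer (suc r) (pred s)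
    ≡⟨ +-assoc (W↑ (suc k) (suc r)) _ _ ⟩
  W↑ (suc k) (suc r) + (W↑ (suc k) (suc r) + s * partialDer (suc r) (pred s))
    ≡⟨ cong (W↑ (suc k) (suc r) +_) (ascentLaw′ r s refl) ⟩
  W↑ (suc k) (suc r) + partialDer (suc r) s ∎
  where
  open ≡-Reasoning
  k = r + s

W-laws : ∀ k → DiffLaw k × AscentLaw k
W-laws zero    = (λ { zero zero refl → refl }) , (λ _ _ ())
W-laws (suc k) = diffLaw-suc k ascentLaw ascentLaw′ , ascentLaw′
  where
  ascentLaw  = proj₂ (W-laws k)
  ascentLaw′ = ascentLaw-suc k (proj₁ (W-laws k)) ascentLaw

W-start-max : ∀ k → W (suc k) (suc k) start ≡ suc k !
W-start-max k = begin
  1 * sumBelow (W↓ k) (suc k) + 1 * sumRange (W↑ k) (suc k) (k ∸ k)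
    ≡⟨ cong₂ _+_ (+-identityʳ _) (cong (λ l → 1 * sumRange (W↑ k) (suc k) l) (n∸n≡0 k)) ⟩
  sumBelow (W↓ k) (suc k) + 0
    ≡⟨ cong (_+ 0) (W↑-suc k (suc k)) ⟨
  W↑ (suc k) (suc k) + 0
    ≡⟨ proj₂ (W-laws (suc k)) k 0 (+-identityʳ (suc k)) ⟩
  partialDer (suc k) 0
    ≡⟨ partialDer-zero (suc k) ⟩
  suc k ! ∎
  where open ≡-Reasoning

alphabet : ℕ → List ℕ
alphabet n = map suc (upTo n)

_∉ᵇ_ : ℕ → List ℕ → Bool
x ∉ᵇ []      = true
x ∉ᵇ (y ∷ U) = not (x ≡ᵇ y) ∧ (x ∉ᵇ U)

avoids : List ℕ → List ℕ → Bool
avoids []      U = true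
avoids (x ∷ w) U = (x ∉ᵇ U) ∧ avoids w U

∉ᵇ-head : ∀ a U → (a ∉ᵇ (a ∷ U)) ≡ false
∉ᵇ-head a U rewrite ≡ᵇ-refl a = refl

<ᵇ⇒∉ᵇ-singleton : ∀ y a → (y <ᵇ a) ≡ true → (y ∉ᵇ (a ∷ [])) ≡ true
<ᵇ⇒∉ᵇ-singleton y a y<a rewrite <ᵇ⇒≡ᵇ-false y a y<a = refl

weightFrom : ℕ → Bool → ℕ → ℕ
weightFrom doubleAscents endsDown doubleDescents =
  if (doubleAscents ≡ᵇ 0) ∧ endsDown then 2 ^ doubleDescents else 0

weight : List ℕ → ℕ
weight w = weightFrom (dasc w) (endsWithDescent w) (bb w)

_⊲_ : Maybe ℕ → List ℕ → List ℕ
nothing ⊲ w = w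
just q  ⊲ w = q ∷ w

-- The weight of the word p a w, counted only if the letters of w are distinct and not in the set U of
-- letters already used; p is the letter preceding a, if any.
extensionWeight : List ℕ → Maybe ℕ → ℕ → List ℕ → ℕ
extensionWeight U p a w = if distinct w ∧ avoids w U then weight (p ⊲ (a ∷ w)) else 0

stepFactor : Maybe ℕ → ℕ → ℕ → ℕ
stepFactor nothing  a b = 1
stepFactor (just q) a b = if (q <ᵇ a) ∧ (a <ᵇ b) then 0 else if (a <ᵇ q) ∧ (b <ᵇ a) then 2 else 1

dirInto : Maybe ℕ → ℕ → Dir
dirInto nothing  a = start
dirInto (just q) a = if q <ᵇ a then up else down

weightFrom-step : ∀ x y d e b →
  weightFrom ((if x then 1 else 0) + d) e ((if y then 1 else 0) + b) ≡ (if x then 0 else if y then 2 else 1) * weightFrom d e b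
weightFrom-step true  y     d e b = refl
weightFrom-step false true  d e b with (d ≡ᵇ 0) ∧ e
... | true  = refl
... | false = refl
weightFrom-step false false d e b = sym (*-identityˡ _)

weight-step : ∀ p a b w → weight (p ⊲ (a ∷ b ∷ w)) ≡ stepFactor p a b * weight (a ∷ b ∷ w)
weight-step nothing  a b w = sym (*-identityˡ _)
weight-step (just q) a b w = weightFrom-step ((q <ᵇ a) ∧ (a <ᵇ b)) ((a <ᵇ q) ∧ (b <ᵇ a))
                                             (dasc (a ∷ b ∷ w)) (endsWithDescent (a ∷ b ∷ w)) (bb (a ∷ b ∷ w))

avoids-[] : ∀ w → avoids w [] ≡ true
avoids-[] []      = refl
avoids-[] (x ∷ w) = avoids-[] w

avoids-∷ : ∀ b w U → not (any (b ≡ᵇ_) w) ∧ avoids w U ≡ avoids w (b ∷ U)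
avoids-∷ b []      U = refl
avoids-∷ b (x ∷ w) U rewrite ≡ᵇ-sym b x with x ≡ᵇ b
... | true  = refl
... | false = trans (∧.x∙yz≈y∙xz (not (any (b ≡ᵇ_) w)) (x ∉ᵇ U) (avoids w U)) (cong ((x ∉ᵇ U) ∧_) (avoids-∷ b w U))

extensionWeight-∷ : ∀ U p a b w →
  extensionWeight U p a (b ∷ w) ≡ (if b ∉ᵇ U then stepFactor p a b else 0) * extensionWeight (b ∷ U) (just a) b w
extensionWeight-∷ U p a b w = begin
  (if (new ∧ distinct w) ∧ ((b ∉ᵇ U) ∧ avoids w U) then weight (p ⊲ (a ∷ b ∷ w)) else 0)
    ≡⟨ cong (λ x → if x then weight (p ⊲ (a ∷ b ∷ w)) else 0) regroup ⟩
  (if (b ∉ᵇ U) ∧ (distinct w ∧ avoids w (b ∷ U)) then weight (p ⊲ (a ∷ b ∷ w)) else 0)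
    ≡⟨ if-∧-* (b ∉ᵇ U) _ (stepFactor p a b) _ _ (weight-step p a b w) ⟩
  (if b ∉ᵇ U then stepFactor p a b else 0) * extensionWeight (b ∷ U) (just a) b w ∎
  where
  open ≡-Reasoning
  new = not (any (b ≡ᵇ_) w)
  regroup : (new ∧ distinct w) ∧ ((b ∉ᵇ U) ∧ avoids w U) ≡ (b ∉ᵇ U) ∧ (distinct w ∧ avoids w (b ∷ U))
  regroup = trans (∧.x∙yz≈y∙xz (new ∧ distinct w) (b ∉ᵇ U) (avoids w U))
                  (cong ((b ∉ᵇ U) ∧_) (trans (∧.xy∙z≈y∙xz new (distinct w) (avoids w U))
                                             (cong (distinct w ∧_) (avoids-∷ b w U))))

stepFactor-split : ∀ p a b (f : Dir → ℕ) → p ≢ just a → a ≢ b →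
  stepFactor p a b * f (dirInto (just a) b)
    ≡ (if b <ᵇ a then descentFactor (dirInto p a) * f down else 0) + (if a <ᵇ b then ascentFactor (dirInto p a) * f up else 0)
stepFactor-split nothing  a b f _ a≢b rewrite <ᵇ-flip a b a≢b with b <ᵇ a
... | true  = sym (+-identityʳ _)
... | false = refl
stepFactor-split (just q) a b f p≢a a≢b rewrite <ᵇ-flip q a (p≢a ∘ cong just) | <ᵇ-flip a b a≢b with a <ᵇ q | b <ᵇ a
... | true  | true  = sym (+-identityʳ _)
... | true  | false = refl
... | false | true  = sym (+-identityʳ _)
... | false | false = refl

alphabet-unique : ∀ n → Unique (alphabet n)
alphabet-unique n = Unique.map⁺ suc-injective (Unique.upTo⁺ n)

alphabet-bounded : ∀ n → All (λ b → (b <ᵇ suc n) ≡ true) (alphabet n)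
alphabet-bounded n = All.map⁺ (All.map (λ i<n → Equivalence.to T-≡ (<⇒<ᵇ i<n)) (All.all-upTo n))

last∈alphabet : ∀ m → suc m ∈ alphabet (suc m)
last∈alphabet m = ∈-map⁺ suc (∈-upTo⁺ ≤-refl)

count-alphabet : ∀ j (Q : ℕ → Bool) → All (λ y → Q y ≡ true) (alphabet j) → Q (suc j) ≡ false →
                 count (alphabet (suc j)) Q ≡ j
count-alphabet j Q Q-below Q-last = begin
  count (alphabet (suc j)) Q                                 ≡⟨ cong (λ l → count (map suc l) Q) (upTo-∷ʳ j) ⟨
  count (map suc (upTo j ++ j ∷ [])) Q                       ≡⟨ cong (λ l → count l Q) (map-++ suc (upTo j) (j ∷ [])) ⟩
  count (alphabet j ++ suc j ∷ []) Q                         ≡⟨ ∑-++ _ (alphabet j) (suc j ∷ []) ⟩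
  count (alphabet j) Q + ((if Q (suc j) then 1 else 0) + 0)  ≡⟨ cong₂ _+_ (∑-congᴬ (All.map (cong (λ x → if x then 1 else 0)) Q-below))
                                                                          (cong (λ x → (if x then 1 else 0) + 0) Q-last) ⟩
  ∑ (alphabet j) (λ _ → 1) + 0                               ≡⟨ +-identityʳ _ ⟩
  ∑ (alphabet j) (λ _ → 1)                                   ≡⟨ ∑-one (alphabet j) ⟩
  length (alphabet j)                                        ≡⟨ length-map suc (upTo j) ⟩
  length (upTo j)                                            ≡⟨ length-upTo j ⟩
  j                                                          ∎
  where open ≡-Reasoning

rank-∉ᵇ-∷ : ∀ L U b → rank L (_∉ᵇ (b ∷ U)) b ≡ rank L (_∉ᵇ U) b
rank-∉ᵇ-∷ L U b = ∑-cong L (λ y → cong (λ x → if x then 1 else 0) (below-b-is-not-b y))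
  where
  below-b-is-not-b : ∀ y → (not (y ≡ᵇ b) ∧ (y ∉ᵇ U)) ∧ (y <ᵇ b) ≡ (y ∉ᵇ U) ∧ (y <ᵇ b)
  below-b-is-not-b y with y <ᵇ b in y<b
  ... | true  rewrite <ᵇ⇒≡ᵇ-false y b y<b = refl
  ... | false = trans (∧-zeroʳ _) (sym (∧-zeroʳ _))

∑-words-suc : ∀ n k (f : List ℕ → ℕ) →
              ∑ (words n (suc k)) f ≡ ∑ (alphabet n) (λ b → ∑ (words n k) (λ w → f (b ∷ w)))
∑-words-suc n k f = trans (∑-concatMap f (λ b → map (b ∷_) (words n k)) (alphabet n))
                          (∑-cong (alphabet n) (λ b → ∑-map f (b ∷_) (words n k)))

∑-extensionWeight≡W : ∀ n k p a U → (a ∉ᵇ U) ≡ false → p ≢ just a → count (alphabet n) (_∉ᵇ U) ≡ k →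
                    ∑ (words n k) (extensionWeight U p a) ≡ W k (rank (alphabet n) (_∉ᵇ U) a) (dirInto p a)
∑-extensionWeight≡W n zero nothing  a U _ _ _ = refl
∑-extensionWeight≡W n zero (just q) a U _ p≢a _ rewrite <ᵇ-flip q a (p≢a ∘ cong just) with a <ᵇ q
... | true  = refl
... | false = refl
∑-extensionWeight≡W n (suc k) p a U a∈U p≢a unused = begin
  ∑ (words n (suc k)) (extensionWeight U p a)
    ≡⟨ ∑-words-suc n k (extensionWeight U p a) ⟩
  ∑ L (λ b → ∑ (words n k) (λ w → extensionWeight U p a (b ∷ w)))
    ≡⟨ ∑-congᴬ (All.tabulate (λ {b} → nextLetter b)) ⟩
  ∑ L (λ b → (if P b ∧ (b <ᵇ a) then ψ↓ (rk b) else 0) + (if P b ∧ (a <ᵇ b) then ψ↑ (rk b) else 0))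
    ≡⟨ ∑-+ {f = λ b → if P b ∧ (b <ᵇ a) then ψ↓ (rk b) else 0} L ⟩
  ∑ L (λ b → if P b ∧ (b <ᵇ a) then ψ↓ (rk b) else 0) + ∑ L (λ b → if P b ∧ (a <ᵇ b) then ψ↑ (rk b) else 0)
    ≡⟨ cong₂ _+_ (∑-below-rank uniq P ψ↓ a) (∑-above-rank uniq P {suc n} (alphabet-bounded n) ψ↑ a a∈U) ⟩
  sumBelow ψ↓ (rk a) + sumRange ψ↑ (rk a) (count L P ∸ rk a)
    ≡⟨ cong₂ _+_ (sumBelow-*ˡ (descentFactor d) (W↓ k) (rk a))
                 (sumRange-*ˡ (ascentFactor d) (W↑ k) (rk a) (count L P ∸ rk a)) ⟩
  descentFactor d * sumBelow (W↓ k) (rk a) + ascentFactor d * sumRange (W↑ k) (rk a) (count L P ∸ rk a)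
    ≡⟨ cong (λ c → descentFactor d * sumBelow (W↓ k) (rk a) + ascentFactor d * sumRange (W↑ k) (rk a) (c ∸ rk a)) unused ⟩
  W (suc k) (rk a) d ∎
  where
  open ≡-Reasoning
  L = alphabet n
  uniq = alphabet-unique n
  P = _∉ᵇ U
  rk = rank L P
  d = dirInto p a
  ψ↓ ψ↑ : ℕ → ℕ
  ψ↓ j = descentFactor d * W↓ k j
  ψ↑ j = ascentFactor d * W↑ k j

  nextLetter : ∀ b → b ∈ L → ∑ (words n k) (λ w → extensionWeight U p a (b ∷ w))
                            ≡ (if P b ∧ (b <ᵇ a) then ψ↓ (rk b) else 0) + (if P b ∧ (a <ᵇ b) then ψ↑ (rk b) else 0)
  nextLetter b b∈L = begin
    ∑ (words n k) (λ w → extensionWeight U p a (b ∷ w))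
      ≡⟨ ∑-cong (words n k) (extensionWeight-∷ U p a b) ⟩
    ∑ (words n k) (λ w → factor * extensionWeight (b ∷ U) (just a) b w)
      ≡⟨ ∑-*ˡ factor (extensionWeight (b ∷ U) (just a) b) (words n k) ⟩
    factor * ∑ (words n k) (extensionWeight (b ∷ U) (just a) b)
      ≡⟨ split (P b) refl ⟩
    (if P b ∧ (b <ᵇ a) then ψ↓ (rk b) else 0) + (if P b ∧ (a <ᵇ b) then ψ↑ (rk b) else 0) ∎
    where
    factor = if P b then stepFactor p a b else 0
    split : ∀ x → P b ≡ x → (if x then stepFactor p a b else 0) * ∑ (words n k) (extensionWeight (b ∷ U) (just a) b)
                           ≡ (if x ∧ (b <ᵇ a) then ψ↓ (rk b) else 0) + (if x ∧ (a <ᵇ b) then ψ↑ (rk b) else 0)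
    split false _  = refl
    split true  Pb = begin
      stepFactor p a b * ∑ (words n k) (extensionWeight (b ∷ U) (just a) b)
        ≡⟨ cong (stepFactor p a b *_)
                (∑-extensionWeight≡W n k (just a) b (b ∷ U) (∉ᵇ-head b U) (a≢b ∘ just-injective) unused′) ⟩
      stepFactor p a b * W k (rank L (_∉ᵇ (b ∷ U)) b) (dirInto (just a) b)
        ≡⟨ cong (λ r → stepFactor p a b * W k r (dirInto (just a) b)) (rank-∉ᵇ-∷ L U b) ⟩
      stepFactor p a b * W k (rk b) (dirInto (just a) b)
        ≡⟨ stepFactor-split p a b (W k (rk b)) p≢a a≢b ⟩
      (if b <ᵇ a then ψ↓ (rk b) else 0) + (if a <ᵇ b then ψ↑ (rk b) else 0) ∎
      where
      a≢b : a ≢ b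
      a≢b refl with () ← trans (sym a∈U) Pb
      unused′ : count L (_∉ᵇ (b ∷ U)) ≡ k
      unused′ = suc-injective (begin
        suc (count L (_∉ᵇ (b ∷ U))) ≡⟨ +-comm 1 _ ⟩
        count L (_∉ᵇ (b ∷ U)) + 1   ≡⟨ count-remove L uniq b b∈L P Pb ⟨
        count L P                   ≡⟨ unused ⟩
        suc k                       ∎)

weightedSum≡∑-extensionWeight : ∀ k → weightedSum (suc k) ≡ ∑ (words (suc k) k) (extensionWeight (suc k ∷ []) nothing (suc k))
weightedSum≡∑-extensionWeight k = begin
  weightedSum n
    ≡⟨ ∑-filter (λ π → 2 ^ bb π) (cond n) (perms n) ⟩
  ∑ (perms n) (λ π → if cond n π then 2 ^ bb π else 0)
    ≡⟨ ∑-filter (λ π → if cond n π then 2 ^ bb π else 0) distinct (words n n) ⟩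
  ∑ (words n n) permutationWeight
    ≡⟨ ∑-words-suc n k permutationWeight ⟩
  ∑ (alphabet n) (λ b → ∑ (words n k) (λ w → permutationWeight (b ∷ w)))
    ≡⟨ ∑-cong (alphabet n) (λ b → trans (∑-cong (words n k) (firstLetter b))
                                        (∑-*ˡ (if b ≡ᵇ n then 1 else 0) rest (words n k))) ⟩
  ∑ (alphabet n) (λ b → (if b ≡ᵇ n then 1 else 0) * S)
    ≡⟨ ∑-*ʳ (λ b → if b ≡ᵇ n then 1 else 0) S (alphabet n) ⟩
  count (alphabet n) (_≡ᵇ n) * S
    ≡⟨ cong (_* S) (count-≡ᵇ-present n (alphabet n) (alphabet-unique n) (last∈alphabet k)) ⟩
  1 * S
    ≡⟨ *-identityˡ S ⟩
  S ∎
  where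
  open ≡-Reasoning
  n = suc k
  rest = extensionWeight (n ∷ []) nothing n
  S = ∑ (words n k) rest
  permutationWeight : List ℕ → ℕ
  permutationWeight π = if distinct π then (if cond n π then 2 ^ bb π else 0) else 0

  firstLetter : ∀ b w → permutationWeight (b ∷ w) ≡ (if b ≡ᵇ n then 1 else 0) * rest w
  firstLetter b w with b ≡ᵇ n in b≡n
  ... | false = if-eta (distinct (b ∷ w))
  ... | true rewrite ≡ᵇ-sound b n b≡n = begin
    (if new ∧ distinct w then weight (n ∷ w) else 0)
      ≡⟨ cong (λ x → if x then weight (n ∷ w) else 0) (trans (∧-comm new (distinct w)) (cong (distinct w ∧_) new≡avoids)) ⟩
    rest w
      ≡⟨ *-identityˡ (rest w) ⟨
    1 * rest w ∎
    where
    new = not (any (n ≡ᵇ_) w)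
    new≡avoids : new ≡ avoids w (n ∷ [])
    new≡avoids = trans (sym (∧-identityʳ new)) (trans (cong (new ∧_) (sym (avoids-[] w))) (avoids-∷ n w []))

count-unused-after-max : ∀ m → count (alphabet (suc m)) (_∉ᵇ (suc m ∷ [])) ≡ m
count-unused-after-max m =
  count-alphabet m (_∉ᵇ (suc m ∷ []))
    (All.map (λ {y} → <ᵇ⇒∉ᵇ-singleton y (suc m)) (alphabet-bounded m)) (∉ᵇ-head (suc m) [])

rank-max : ∀ m → rank (alphabet (suc m)) (_∉ᵇ (suc m ∷ [])) (suc m) ≡ m
rank-max m = count-alphabet m (λ y → (y ∉ᵇ (suc m ∷ [])) ∧ (y <ᵇ suc m))
               (All.map (λ {y} y<n → trans (cong (_∧ (y <ᵇ suc m)) (<ᵇ⇒∉ᵇ-singleton y (suc m) y<n)) y<n) (alphabet-bounded m))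
               (cong (_∧ (suc m <ᵇ suc m)) (∉ᵇ-head (suc m) []))

corollary3p5 : (n : ℕ) → 2 ≤ n → weightedSum n ≡ (n ∸ 1) !
corollary3p5 n@(suc (suc m)) (s≤s (s≤s z≤n)) = begin
  weightedSum n
    ≡⟨ weightedSum≡∑-extensionWeight (suc m) ⟩
  ∑ (words n (suc m)) (extensionWeight (n ∷ []) nothing n)
    ≡⟨ ∑-extensionWeight≡W n (suc m) nothing n (n ∷ []) (∉ᵇ-head n []) (λ ()) (count-unused-after-max (suc m)) ⟩
  W (suc m) (rank (alphabet n) (_∉ᵇ (n ∷ [])) n) start
    ≡⟨ cong (λ r → W (suc m) r start) (rank-max (suc m)) ⟩
  W (suc m) (suc m) start
    ≡⟨ W-start-max m ⟩
  suc m ! ∎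
  where open ≡-Reasoning
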